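{- Let $J=(k,X=X_1\uplus\dots\uplus X_k,\mathcal{R})$ be an instance of \textsc{Binary Constrained Partition Center} with $X\subseteq\{0,1\}^m$ and $\mathcal{R}=(R_1,\dots,R_m)$, let $(\mathbf{c}^*_1,\dots,\mathbf{c}^*_k)$ be an optimal solution for $J$, and let $r\ge2$ be an integer. Then there exist $\{\mathbf{x}^{(1)}_1,\dots,\mathbf{x}^{(r)}_1\}\subset X_1,\dots,\{\mathbf{x}^{(1)}_k,\dots,\mathbf{x}^{(r)}_k\}\subset X_k$ with the following properties. For each $i\in\{1,\dots,k\}$ let $Q_i$ be the set of coordinates on which $\mathbf{x}^{(1)}_i,\dots,\mathbf{x}^{(r)}_i$ all agree, let \[Q=\Big\{j\in\bigcap_{i=1}^kQ_i:(\mathbf{x}^{(1)}_1[j],\mathbf{x}^{(1)}_2[j],\dots,\mathbf{x}^{(1)}_k[j])\in R_j\Big\},\] and let $\overline{Q}=\{1,\dots,m\}\setminus Q$. Then: (1) for every $i\in\{1,\dots,k\}$ and $\mathbf{x}\in X_i$, $d_H^Q(\mathbf{x},\mathbf{x}^{(1)}_i)-d_H^Q(\mathbf{x},\mathbf{c}^*_i)\le\frac{1}{r-1}\mathrm{OPT}(J)$; and (2) $|\overline{Q}|\le rk\cdot\mathrm{OPT}(J)$.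
   Context: $d_H$ is Hamming distance on $\{0,1\}^m$; for $P\subseteq\{1,\dots,m\}$, $d_H^P(\mathbf{x},\mathbf{y})=\sum_{i\in P}|x_i-y_i|$. A $k$-ary relation is a set of $k$-tuples with entries in $\{0,1\}$. A tuple $C=(\mathbf{c}_1,\dots,\mathbf{c}_k)$ of vectors in $\{0,1\}^m$ satisfies $\mathcal{R}=(R_1,\dots,R_m)$ if $(\mathbf{c}_1[i],\dots,\mathbf{c}_k[i])\in R_i$ for all $i$. \textsc{Binary Constrained Partition Center}: given a positive integer $k$, a set $X\subseteq\{0,1\}^m$ partitioned as $X_1\uplus\dots\uplus X_k$, and a tuple $\mathcal{R}$ of $k$-ary relations, find $C=(\mathbf{c}_1,\dots,\mathbf{c}_k)$ satisfying $\mathcal{R}$ minimizing $\max_{i,\mathbf{x}\in X_i}d_H(\mathbf{x},\mathbf{c}_i)$; $\mathrm{OPT}(J)$ is this minimum and an optimal solution is a tuple attaining it. -}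

module Defs where

open import Data.Nat using (ℕ; zero; suc; _+_; _⊔_; _≤_; s≤s; z≤n)
open import Data.Bool using (Bool; true; false; _∧_; if_then_else_; _xor_; not)
open import Data.Fin using (Fin; zero; suc)
open import Data.Fin.Subset using (Subset)
open import Data.Vec using (Vec; lookup; tabulate; foldr′)
open import Data.List using (List)
import Data.List as L
open import Data.List.Membership.Propositional using (_∈_)
open import Relation.Binary.PropositionalEquality using (_≡_)

BVec : ℕ → Set
BVec m = Vec Bool m

Relation : ℕ → Set
Relation k = Vec Bool k → Bool

sumFin : ∀ {m} → (Fin m → ℕ) → ℕ
sumFin f = foldr′ _+_ 0 (tabulate f)

dHP : ∀ {m} → Subset m → BVec m → BVec m → ℕ
dHP P x y = sumFin λ j → if lookup P j ∧ (lookup x j xor lookup y j) then 1 else 0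

dH : ∀ {m} → BVec m → BVec m → ℕ
dH x y = sumFin λ j → if lookup x j xor lookup y j then 1 else 0

maxList : List ℕ → ℕ
maxList = L.foldr _⊔_ 0

cost : ∀ {k m} → (Fin k → List (BVec m)) → (Fin k → BVec m) → ℕ
cost {k} X C = sumMax
  where
  sumMax : ℕ
  sumMax = foldr′ _⊔_ 0 (tabulate λ i → maxList (L.map (λ x → dH x (C i)) (X i)))

Satisfies : ∀ {k m} → (Fin m → Relation k) → (Fin k → BVec m) → Set
Satisfies R C = ∀ j → R j (tabulate λ i → lookup (C i) j) ≡ true

Optimal : ∀ {k m} → (Fin k → List (BVec m)) → (Fin m → Relation k)
        → (Fin k → BVec m) → Set
Optimal X R C = Satisfies R C × (∀ C′ → Satisfies R C′ → cost X C ≤ cost X C′)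
  where open import Data.Product using (_×_)

-- the index of the first vector x^(1) among r ≥ 2 chosen vectors
first : ∀ {r} → 2 ≤ r → Fin r
first (s≤s _) = zero

eqB : Bool → Bool → Bool
eqB a b = not (a xor b)

allFin : ∀ {r} → (Fin r → Bool) → Bool
allFin f = foldr′ _∧_ true (tabulate f)

-- The coordinate set Q determined by chosen vectors xs i a (a-th chosen
-- vector of part i; x^(1)_i = xs i (first r≥2)):
-- j ∈ Q iff all xs i a agree at j for every i, and (x^(1)_1[j],…,x^(1)_k[j]) ∈ R_j
Qset : ∀ {k m r} → (Fin m → Relation k) → (r≥2 : 2 ≤ r)
     → (Fin k → Fin r → BVec m) → Subset m
Qset {k} R r≥2 xs = tabulate λ j →
  allFin (λ i → allFin (λ a → eqB (lookup (xs i a) j) (lookup (xs i (first r≥2)) j)))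
  ∧ R j (tabulate λ i → lookup (xs i (first r≥2)) j)

module Submission where

-- Fix a part i, an arbitrary y ∈ X_i and the optimal center c = c*_i, and
-- let d = OPT.  Maintain a set A of "active" coordinates, initially all of
-- them.  While some x ∈ X_i is correct (x[j] = c[j]) on more than d/(r-1)
-- active coordinates where y is wrong, pick such an x and keep active only
-- the coordinates where x agrees with y.  The number of active coordinates
-- where y is wrong starts at d_H(y,c) ≤ d and drops by more than d/(r-1)
-- per pick, so within r-1 rounds no such x is left.  The chosen vectors are
-- y together with the r-1 greedy picks.  On Q every pick agrees with y, so
-- Q lies inside the final active set, and d_H^Q(x,y) ≤ d_H^Q(x,c) + (number
-- of final active coordinates where y is wrong but x is right), which gives
-- (1).  For (2): a coordinate where every chosen vector equals its optimal
-- center lies in Q because C* satisfies R, so |Q̄| is at most the sum of the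
-- r·k distances d_H(x_i^(a), c*_i) ≤ OPT.

open import Defs
import Algebra.Properties.CommutativeMonoid.Sum as MonoidSum
open import Data.Nat using (ℕ; zero; suc; _+_; _*_; _∸_; _≤_; _<_; _⊔_; z≤n; s≤s; _<?_; NonZero)
open import Data.Nat.Properties
open import Data.Bool using (Bool; true; false; _∧_; if_then_else_; _xor_; not)
open import Data.Fin using (Fin; zero; suc; toℕ; fromℕ<)
open import Data.Fin.Properties using (toℕ-fromℕ<)
open import Data.Fin.Subset using (Subset; ∁; ∣_∣)
open import Data.Vec using ([]; _∷_; lookup; tabulate; foldr′)
open import Data.Vec.Properties using (lookup∘tabulate; tabulate-cong)
open import Data.List using (List; _∷_)
import Data.List as L
open import Data.List.Relation.Unary.Any using (here; there; any?)
open import Data.List.Membership.Propositional using (_∈_; find; lose)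
open import Data.Product using (Σ; _×_; _,_; proj₁; proj₂)
open import Data.Sum using (_⊎_; inj₁; inj₂)
open import Relation.Nullary using (yes; no; contradiction)
open import Relation.Binary.PropositionalEquality hiding ([_])

open MonoidSum +-0-commutativeMonoid using (sum; sum-cong-≗; ∑-distrib-+; ∑-comm)

[_] : Bool → ℕ
[ b ] = if b then 1 else 0

-- sumFin is the library's monoid sum, so the library's algebra of sums applies.
sumFin≡sum : ∀ {m} (f : Fin m → ℕ) → sumFin f ≡ sum f
sumFin≡sum {zero} f = refl
sumFin≡sum {suc m} f = cong (f zero +_) (sumFin≡sum (λ j → f (suc j)))

sumFin-cong : ∀ {m} {f g : Fin m → ℕ} → (∀ j → f j ≡ g j) → sumFin f ≡ sumFin g
sumFin-cong {f = f} {g} f≗g =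
  trans (sumFin≡sum f) (trans (sum-cong-≗ f≗g) (sym (sumFin≡sum g)))

sumFin-+ : ∀ {m} (f g : Fin m → ℕ) → sumFin (λ j → f j + g j) ≡ sumFin f + sumFin g
sumFin-+ f g = begin
  sumFin (λ j → f j + g j) ≡⟨ sumFin≡sum (λ j → f j + g j) ⟩
  sum (λ j → f j + g j)    ≡⟨ ∑-distrib-+ f g ⟩
  sum f + sum g            ≡⟨ sym (cong₂ _+_ (sumFin≡sum f) (sumFin≡sum g)) ⟩
  sumFin f + sumFin g      ∎
  where open ≡-Reasoning

sumFin-comm : ∀ {m n} (f : Fin m → Fin n → ℕ) →
  sumFin (λ i → sumFin (f i)) ≡ sumFin (λ j → sumFin (λ i → f i j))
sumFin-comm f = begin
  sumFin (λ i → sumFin (f i))             ≡⟨ sumFin≡sum (λ i → sumFin (f i)) ⟩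
  sum (λ i → sumFin (f i))                ≡⟨ sum-cong-≗ (λ i → sumFin≡sum (f i)) ⟩
  sum (λ i → sum (f i))                   ≡⟨ ∑-comm f ⟩
  sum (λ j → sum (λ i → f i j))           ≡⟨ sum-cong-≗ (λ j → sym (sumFin≡sum (λ i → f i j))) ⟩
  sum (λ j → sumFin (λ i → f i j))        ≡⟨ sym (sumFin≡sum (λ j → sumFin (λ i → f i j))) ⟩
  sumFin (λ j → sumFin (λ i → f i j))     ∎
  where open ≡-Reasoning

sumFin-mono : ∀ {m} {f g : Fin m → ℕ} → (∀ j → f j ≤ g j) → sumFin f ≤ sumFin g
sumFin-mono {zero} f≤g = z≤n
sumFin-mono {suc m} f≤g = +-mono-≤ (f≤g zero) (sumFin-mono (λ j → f≤g (suc j)))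

sumFin-const : ∀ m c → sumFin {m} (λ _ → c) ≡ m * c
sumFin-const zero c = refl
sumFin-const (suc m) c = cong (c +_) (sumFin-const m c)

sumFin-zero : ∀ {m} (f : Fin m → ℕ) → sumFin f ≡ 0 → ∀ j → f j ≡ 0
sumFin-zero f f≡0 zero = m+n≡0⇒m≡0 (f zero) f≡0
sumFin-zero f f≡0 (suc j) = sumFin-zero (λ j → f (suc j)) (m+n≡0⇒n≡0 (f zero) f≡0) j

∣∁∣-sum : ∀ {m} (P : Subset m) → ∣ ∁ P ∣ ≡ sumFin (λ j → [ not (lookup P j) ])
∣∁∣-sum [] = refl
∣∁∣-sum (true ∷ P) = ∣∁∣-sum P
∣∁∣-sum (false ∷ P) = cong suc (∣∁∣-sum P)

∧-elimˡ : ∀ a {b} → a ∧ b ≡ true → a ≡ true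
∧-elimˡ true _ = refl

∧-elimʳ : ∀ a {b} → a ∧ b ≡ true → b ≡ true
∧-elimʳ true b≡true = b≡true

eqB-sound : ∀ a b → eqB a b ≡ true → a ≡ b
eqB-sound false false _ = refl
eqB-sound true true _ = refl

eqB-complete : ∀ {a b} → a ≡ b → eqB a b ≡ true
eqB-complete {false} refl = refl
eqB-complete {true} refl = refl

xor-zero : ∀ a b → [ a xor b ] ≡ 0 → a ≡ b
xor-zero false false _ = refl
xor-zero true true _ = refl

allFin-elim : ∀ {r} (f : Fin r → Bool) → allFin f ≡ true → ∀ a → f a ≡ true
allFin-elim f all zero = ∧-elimˡ (f zero) all
allFin-elim f all (suc a) = allFin-elim (λ a → f (suc a)) (∧-elimʳ (f zero) all) a

allFin-intro : ∀ {r} (f : Fin r → Bool) → (∀ a → f a ≡ true) → allFin f ≡ true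
allFin-intro {zero} f _ = refl
allFin-intro {suc r} f all rewrite all zero = allFin-intro (λ a → f (suc a)) (λ a → all (suc a))

module _ {k m r} (R : Fin m → Relation k) (r≥2 : 2 ≤ r) (xs : Fin k → Fin r → BVec m) where

  private
    x₁ : Fin k → BVec m
    x₁ i = xs i (first r≥2)

  Qset-agree : ∀ j → lookup (Qset R r≥2 xs) j ≡ true → ∀ i a → lookup (xs i a) j ≡ lookup (x₁ i) j
  Qset-agree j j∈Q i a = eqB-sound _ _
    (allFin-elim _ (allFin-elim _ (∧-elimˡ _ (trans (sym (lookup∘tabulate _ j)) j∈Q)) i) a)

  Qset-intro : ∀ j → (∀ i a → lookup (xs i a) j ≡ lookup (x₁ i) j)
    → R j (tabulate λ i → lookup (x₁ i) j) ≡ true → lookup (Qset R r≥2 xs) j ≡ true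
  Qset-intro j agree inR = trans (lookup∘tabulate _ j) (cong₂ _∧_
    (allFin-intro _ λ i → allFin-intro _ λ a → eqB-complete (agree i a)) inR)

maxList-upper : ∀ {A : Set} (h : A → ℕ) (xs : List A) x → x ∈ xs → h x ≤ maxList (L.map h xs)
maxList-upper h (y ∷ xs) x (here refl) = m≤m⊔n _ _
maxList-upper h (y ∷ xs) x (there x∈xs) = ≤-trans (maxList-upper h xs x x∈xs) (m≤n⊔m (h y) _)

foldr⊔-upper : ∀ {k} (g : Fin k → ℕ) i → g i ≤ foldr′ _⊔_ 0 (tabulate g)
foldr⊔-upper g zero = m≤m⊔n _ _
foldr⊔-upper g (suc i) = ≤-trans (foldr⊔-upper (λ i → g (suc i)) i) (m≤n⊔m (g zero) _)

dH≤cost : ∀ {k m} (X : Fin k → List (BVec m)) C i x → x ∈ X i → dH x (C i) ≤ cost X C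
dH≤cost X C i x x∈Xi = ≤-trans (maxList-upper (λ x → dH x (C i)) (X i) x x∈Xi)
  (foldr⊔-upper (λ i → maxList (L.map (λ x → dH x (C i)) (X i))) i)

Coords : ℕ → Set
Coords m = Fin m → Bool

wrong : ∀ {m} → BVec m → BVec m → Coords m → ℕ
wrong y c A = sumFin λ j → [ A j ∧ (lookup y j xor lookup c j) ]

gain : ∀ {m} → BVec m → BVec m → Coords m → BVec m → ℕ
gain y c A x = sumFin λ j → [ A j ∧ (lookup y j xor lookup c j) ∧ eqB (lookup x j) (lookup c j) ]

agreeing : ∀ {m} → BVec m → BVec m → Coords m → Coords m
agreeing y x A j = A j ∧ eqB (lookup x j) (lookup y j)

-- A coordinate where y is wrong either keeps x agreeing with y, or x is
-- right there; so restricting to `agreeing` removes exactly the gain.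
wrong-split : ∀ {m} (y c x : BVec m) A → wrong y c (agreeing y x A) + gain y c A x ≡ wrong y c A
wrong-split {m} y c x A = trans (sym (sumFin-+ stillWrong nowRight)) (sumFin-cong λ j →
  pointwise (A j) (lookup x j) (lookup y j) (lookup c j))
  where
  stillWrong nowRight : Fin m → ℕ
  stillWrong j = [ agreeing y x A j ∧ (lookup y j xor lookup c j) ]
  nowRight j = [ A j ∧ (lookup y j xor lookup c j) ∧ eqB (lookup x j) (lookup c j) ]

  pointwise : ∀ a x y c → [ (a ∧ eqB x y) ∧ (y xor c) ] + [ a ∧ (y xor c) ∧ eqB x c ] ≡ [ a ∧ (y xor c) ]
  pointwise false _ _ _ = refl
  pointwise true false false false = refl
  pointwise true false false true = refl
  pointwise true false true false = refl
  pointwise true false true true = refl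
  pointwise true true false false = refl
  pointwise true true false true = refl
  pointwise true true true false = refl
  pointwise true true true true = refl

gain-mono : ∀ {m} (y c x : BVec m) {A B : Coords m} → (∀ j → B j ≡ true → A j ≡ true)
  → gain y c B x ≤ gain y c A x
gain-mono y c x {A} {B} B⊆A = sumFin-mono λ j → pointwise (B j) (A j) (B⊆A j)
  where
  pointwise : ∀ b a {t} → (b ≡ true → a ≡ true) → [ b ∧ t ] ≤ [ a ∧ t ]
  pointwise false a _ = z≤n
  pointwise true a b⇒a rewrite b⇒a refl = ≤-refl

-- Triangle-type inequality: on Q ⊆ A, x can be farther from y than from c
-- only on coordinates where y is wrong and x is right.
dHP-via-gain : ∀ {m} (Q : Subset m) (A : Coords m) → (∀ j → lookup Q j ≡ true → A j ≡ true)
  → (x y c : BVec m) → dHP Q x y ≤ dHP Q x c + gain y c A x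
dHP-via-gain {m} Q A Q⊆A x y c = ≤-trans (sumFin-mono pointwise) (≤-reflexive (sumFin-+ farFromC gainAt))
  where
  farFromC gainAt : Fin m → ℕ
  farFromC j = [ lookup Q j ∧ (lookup x j xor lookup c j) ]
  gainAt j = [ A j ∧ (lookup y j xor lookup c j) ∧ eqB (lookup x j) (lookup c j) ]

  triangle : ∀ x y c → [ x xor y ] ≤ [ x xor c ] + [ true ∧ (y xor c) ∧ eqB x c ]
  triangle false false false = z≤n
  triangle false false true = z≤n
  triangle false true false = s≤s z≤n
  triangle false true true = s≤s z≤n
  triangle true false false = s≤s z≤n
  triangle true false true = s≤s z≤n
  triangle true true false = z≤n
  triangle true true true = z≤n

  pointwise : ∀ j → [ lookup Q j ∧ (lookup x j xor lookup y j) ] ≤ farFromC j + gainAt j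
  pointwise j with lookup Q j in j∈Q
  ... | false = z≤n
  ... | true rewrite Q⊆A j j∈Q = triangle (lookup x j) (lookup y j) (lookup c j)

module Greedy {m} (cands : List (BVec m)) (y c : BVec m) (d n : ℕ) .{{_ : NonZero n}} where

  Settled : Coords m → Set
  Settled A = ∀ x → x ∈ cands → n * gain y c A x ≤ d

  Violator : Coords m → Set
  Violator A = Σ (BVec m) λ x → x ∈ cands × d < n * gain y c A x

  classify : ∀ A → Settled A ⊎ Violator A
  classify A with any? (λ x → d <? n * gain y c A x) cands
  ... | yes some = inj₂ (find some)
  ... | no none = inj₁ λ x x∈cands → ≮⇒≥ λ violates → none (lose x∈cands violates)

  pickFrom : ∀ A → Settled A ⊎ Violator A → BVec m
  pickFrom A (inj₁ _) = y
  pickFrom A (inj₂ (x , _)) = x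

  pick : Coords m → BVec m
  pick A = pickFrom A (classify A)

  pick-violates : ∀ A → Settled A ⊎ d < n * gain y c A (pick A)
  pick-violates A = spec (classify A)
    where
    spec : (o : Settled A ⊎ Violator A) → Settled A ⊎ d < n * gain y c A (pickFrom A o)
    spec (inj₁ settled) = inj₁ settled
    spec (inj₂ (_ , _ , violates)) = inj₂ violates

  pick-∈ : y ∈ cands → ∀ A → pick A ∈ cands
  pick-∈ y∈cands A = member (classify A)
    where
    member : (o : Settled A ⊎ Violator A) → pickFrom A o ∈ cands
    member (inj₁ _) = y∈cands
    member (inj₂ (_ , x∈cands , _)) = x∈cands

  active : ℕ → Coords m
  active zero _ = true
  active (suc t) = agreeing y (pick (active t)) (active t)

  picked : ℕ → BVec m
  picked t = pick (active t)

  settled-agreeing : ∀ A x → Settled A → Settled (agreeing y x A)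
  settled-agreeing A x settled z z∈cands =
    ≤-trans (*-monoʳ-≤ n (gain-mono y c z λ j → ∧-elimˡ (A j))) (settled z z∈cands)

  violator-step : ∀ A x t → d < n * gain y c A x → n * wrong y c A + t * suc d ≤ n * d
    → n * wrong y c (agreeing y x A) + suc t * suc d ≤ n * d
  violator-step A x t violates bound = begin
    n * W′ + (suc d + t * suc d)  ≤⟨ +-monoʳ-≤ (n * W′) (+-monoˡ-≤ (t * suc d) violates) ⟩
    n * W′ + (n * G + t * suc d)  ≡⟨ +-assoc (n * W′) (n * G) (t * suc d) ⟨
    n * W′ + n * G + t * suc d    ≡⟨ cong (_+ t * suc d) (*-distribˡ-+ n W′ G) ⟨
    n * (W′ + G) + t * suc d      ≡⟨ cong (λ w → n * w + t * suc d) (wrong-split y c x A) ⟩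
    n * wrong y c A + t * suc d   ≤⟨ bound ⟩
    n * d                         ∎
    where
    open ≤-Reasoning
    W′ G : ℕ
    W′ = wrong y c (agreeing y x A)
    G = gain y c A x

  -- Invariant: after t rounds either the active set is settled, or at most
  -- d - t(d+1)/n wrong coordinates of y remain active.
  Progress : ℕ → Set
  Progress t = Settled (active t) ⊎ n * wrong y c (active t) + t * suc d ≤ n * d

  -- Initially all coordinates are active, so wrong y c (active 0) is dH y c.
  progress : dH y c ≤ d → ∀ t → Progress t
  progress y≤d zero = inj₂ (subst (_≤ n * d) (sym (+-identityʳ _)) (*-monoʳ-≤ n y≤d))
  progress y≤d (suc t) = next (progress y≤d t) (pick-violates (active t))
    where
    A : Coords m
    A = active t
    next : Progress t → Settled A ⊎ d < n * gain y c A (picked t) → Progress (suc t)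
    next (inj₁ settled) _ = inj₁ (settled-agreeing A (picked t) settled)
    next (inj₂ _) (inj₁ settled) = inj₁ (settled-agreeing A (picked t) settled)
    next (inj₂ bound) (inj₂ violates) = inj₂ (violator-step A (picked t) t violates bound)

  -- After n rounds the active set is settled, since n(d+1) > nd.
  settled : dH y c ≤ d → Settled (active n)
  settled y≤d with progress y≤d n
  ... | inj₁ done = done
  ... | inj₂ bound = contradiction bound (<⇒≱ (begin-strict
    n * d                               <⟨ *-monoʳ-< n (n<1+n d) ⟩
    n * suc d                           ≤⟨ m≤n+m (n * suc d) (n * wrong y c (active n)) ⟩
    n * wrong y c (active n) + n * suc d ∎))
    where open ≤-Reasoning

  stays-active : ∀ j u → (∀ t → t < u → lookup (picked t) j ≡ lookup y j) → active u j ≡ true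
  stays-active j zero _ = refl
  stays-active j (suc u) agree = cong₂ _∧_
    (stays-active j u λ t t<u → agree t (m<n⇒m<1+n t<u)) (eqB-complete (agree u (n<1+n u)))

  -- The same, with the rounds indexed by Fin n as the chosen vectors are.
  survives : ∀ j → (∀ (t : Fin n) → lookup (picked (toℕ t)) j ≡ lookup y j) → active n j ≡ true
  survives j agree = stays-active j n λ t t<n →
    subst (λ u → lookup (picked u) j ≡ lookup y j) (toℕ-fromℕ< t<n) (agree (fromℕ< t<n))

  -- Property (1) for this part: on any Q inside the final active set, y is
  -- at most d/n farther than c from every candidate.
  greedy-bound : dH y c ≤ d → (Q : Subset m) → (∀ j → lookup Q j ≡ true → active n j ≡ true)
    → ∀ x → x ∈ cands → n * dHP Q x y ≤ n * dHP Q x c + d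
  greedy-bound y≤d Q Q⊆active x x∈cands = begin
    n * dHP Q x y                ≤⟨ *-monoʳ-≤ n (dHP-via-gain Q (active n) Q⊆active x y c) ⟩
    n * (dHP Q x c + G)          ≡⟨ *-distribˡ-+ n (dHP Q x c) G ⟩
    n * dHP Q x c + n * G        ≤⟨ +-monoʳ-≤ (n * dHP Q x c) (settled y≤d x x∈cands) ⟩
    n * dHP Q x c + d            ∎
    where
    open ≤-Reasoning
    G : ℕ
    G = gain y c (active n) x

-- Bound on the complement of Q: a coordinate outside Q is one where some
-- chosen vector differs from its center, so |Q̄| is at most the total
-- distance of the chosen vectors to their centers.
∣∁∣≤total-distance : ∀ {k r m} (Q : Subset m) (vs : Fin k → Fin r → BVec m) (c : Fin k → BVec m)
  → (∀ j → (∀ i a → lookup (vs i a) j ≡ lookup (c i) j) → lookup Q j ≡ true)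
  → ∣ ∁ Q ∣ ≤ sumFin (λ i → sumFin (λ a → dH (vs i a) (c i)))
∣∁∣≤total-distance {k} {r} {m} Q vs c agree⇒Q = begin
  ∣ ∁ Q ∣                                                   ≡⟨ ∣∁∣-sum Q ⟩
  sumFin (λ j → [ not (lookup Q j) ])                       ≤⟨ sumFin-mono outside≤misses ⟩
  sumFin (λ j → sumFin λ i → sumFin λ a → miss i a j)       ≡⟨ sumFin-comm (λ j i → sumFin λ a → miss i a j) ⟩
  sumFin (λ i → sumFin λ j → sumFin λ a → miss i a j)       ≡⟨ sumFin-cong (λ i → sumFin-comm (λ j a → miss i a j)) ⟩
  sumFin (λ i → sumFin λ a → dH (vs i a) (c i))             ∎
  where
  open ≤-Reasoning
  miss : Fin k → Fin r → Fin m → ℕ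
  miss i a j = [ lookup (vs i a) j xor lookup (c i) j ]

  misses : Fin m → ℕ
  misses j = sumFin λ i → sumFin λ a → miss i a j

  indicator≤1 : ∀ b → [ b ] ≤ 1
  indicator≤1 true = s≤s z≤n
  indicator≤1 false = z≤n

  outside≤misses : ∀ j → [ not (lookup Q j) ] ≤ misses j
  outside≤misses j with misses j in total
  ... | suc _ = ≤-trans (indicator≤1 _) (s≤s z≤n)
  ... | zero rewrite agree⇒Q j (λ i a → xor-zero _ _
          (sumFin-zero (λ a → miss i a j) (sumFin-zero (λ i → sumFin (λ a → miss i a j)) total i) a)) = z≤n

sumFin²≤ : ∀ {k r} (f : Fin k → Fin r → ℕ) d → (∀ i a → f i a ≤ d)
  → sumFin (λ i → sumFin (f i)) ≤ r * k * d
sumFin²≤ {k} {r} f d f≤d = begin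
  sumFin (λ i → sumFin (f i))               ≤⟨ sumFin-mono (λ i → sumFin-mono (f≤d i)) ⟩
  sumFin {k} (λ i → sumFin {r} λ a → d)     ≡⟨ sumFin-cong {k} (λ i → sumFin-const r d) ⟩
  sumFin {k} (λ i → r * d)                  ≡⟨ sumFin-const k (r * d) ⟩
  k * (r * d)                               ≡⟨ *-assoc k r d ⟨
  k * r * d                                 ≡⟨ cong (_* d) (*-comm k r) ⟩
  r * k * d                                 ∎
  where open ≤-Reasoning

-- The main result.  The chosen vectors of part i are y_i ∈ X_i followed by
-- the r-1 greedy picks against c*_i with budget OPT.
lemma4 : (k m : ℕ) → 1 ≤ k
    → (X : Fin k → List (BVec m))
    → (∀ i → Σ (BVec m) λ x → x ∈ X i)
    → (∀ i i′ x → x ∈ X i → x ∈ X i′ → i ≡ i′)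
    → (R : Fin m → Relation k)
    → (C* : Fin k → BVec m) → Optimal X R C*
    → (r : ℕ) → (r≥2 : 2 ≤ r)
    → Σ (Fin k → Fin r → BVec m) λ xs →
    (∀ i a → xs i a ∈ X i)
    × (∀ i x → x ∈ X i →
    (r ∸ 1) * dHP (Qset R r≥2 xs) x (xs i (first r≥2))
    ≤ (r ∸ 1) * dHP (Qset R r≥2 xs) x (C* i) + cost X C*)
    × (∣ ∁ (Qset R r≥2 xs) ∣ ≤ r * k * cost X C*)
lemma4 k m _ X nonempty _ R C* (C*-satisfies , _) (suc (suc r′)) r≥2@(s≤s (s≤s z≤n)) =
  xs , xs∈X , part1 , part2
  where
  d n : ℕ
  d = cost X C*
  n = suc r′

  y : Fin k → BVec m
  y i = proj₁ (nonempty i)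
  module G i = Greedy (X i) (y i) (C* i) d n

  xs : Fin k → Fin (suc n) → BVec m
  xs i zero = y i
  xs i (suc a) = G.picked i (toℕ a)

  xs∈X : ∀ i a → xs i a ∈ X i
  xs∈X i zero = proj₂ (nonempty i)
  xs∈X i (suc a) = G.pick-∈ i (proj₂ (nonempty i)) _

  Q : Subset m
  Q = Qset R r≥2 xs

  y-near : ∀ i → dH (y i) (C* i) ≤ d
  y-near i = dH≤cost X C* i (y i) (proj₂ (nonempty i))

  part1 : ∀ i x → x ∈ X i → n * dHP Q x (y i) ≤ n * dHP Q x (C* i) + d
  part1 i = G.greedy-bound i (y-near i) Q λ j j∈Q →
    G.survives i j λ t → Qset-agree R r≥2 xs j j∈Q i (suc t)

  -- Where every chosen vector equals its center, C* satisfying R puts j in Q.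
  agree⇒Q : ∀ j → (∀ i a → lookup (xs i a) j ≡ lookup (C* i) j) → lookup Q j ≡ true
  agree⇒Q j agree = Qset-intro R r≥2 xs j (λ i a → trans (agree i a) (sym (agree i zero)))
    (trans (cong (R j) (tabulate-cong λ i → agree i zero)) (C*-satisfies j))

  part2 : ∣ ∁ Q ∣ ≤ suc n * k * d
  part2 = ≤-trans (∣∁∣≤total-distance Q xs C* agree⇒Q)
    (sumFin²≤ (λ i a → dH (xs i a) (C* i)) d λ i a → dH≤cost X C* i (xs i a) (xs∈X i a))
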